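{- Let $C^*_5$ denote the cycle of length $5$ with one chord. Then the matching polytope $P_M(C^*_5)$ has the integer decomposition property.
   Context: For a graph $G$ with edge set $E$, $P_M(G)\subset\mathbb{R}^E$ is the convex hull of the indicator vectors of all matchings of $G$. A lattice polytope $P\subset\mathbb{R}^d$ has the integer decomposition property if for every $t\in\mathbb{Z}_{>0}$ and $\alpha\in tP\cap\mathbb{Z}^d$ there exist $\alpha_1,\dots,\alpha_t\in P\cap\mathbb{Z}^d$ with $\alpha=\sum\alpha_i$.
   Formalization: The coefficients of the combinations of matching indicator vectors that express membership in $tP$ and in $P$ are taken in the rationals rather than the reals. -}

module Defs where

open import Data.Nat using (ℕ; zero; suc)
open import Data.Fin using (Fin; zero; suc)
open import Data.Bool using (Bool; true; false; if_then_else_)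
open import Data.Integer using (ℤ; +_)
open import Data.Rational using (ℚ; _/_; 0ℚ; 1ℚ; _+_; _*_; _≤_)
open import Data.Product using (Σ; _×_; _,_; proj₁; proj₂; ∃)
open import Data.List using (List; []; _∷_)
open import Data.List.Relation.Unary.All using (All)
open import Relation.Binary.PropositionalEquality using (_≡_; _≢_)
open import Relation.Nullary using (¬_)

-- The graph C*_5: the 5-cycle on vertices 0,1,2,3,4 with edges
-- 01, 12, 23, 34, 40, plus the chord 02.  Edges are indexed by Fin 6.
Vertex : Set
Vertex = Fin 5

Edge : Set
Edge = Fin 6

ends : Edge → Vertex × Vertex
ends zero                               = (zero , suc zero)
ends (suc zero)                         = (suc zero , suc (suc zero))
ends (suc (suc zero))                   = (suc (suc zero) , suc (suc (suc zero)))
ends (suc (suc (suc zero)))             = (suc (suc (suc zero)) , suc (suc (suc (suc zero))))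
ends (suc (suc (suc (suc zero))))       = (suc (suc (suc (suc zero))) , zero)
ends (suc (suc (suc (suc (suc zero))))) = (zero , suc (suc zero))

Incident : Vertex → Edge → Set
Incident v e = (v ≡ proj₁ (ends e)) Data.Sum.⊎ (v ≡ proj₂ (ends e))
  where import Data.Sum

IsMatching : (Edge → Bool) → Set
IsMatching S = ∀ e f → S e ≡ true → S f ≡ true → e ≢ f →
  ∀ v → Incident v e → ¬ Incident v f

Matching : Set
Matching = Σ (Edge → Bool) IsMatching

χ : Matching → Edge → ℚ
χ (S , _) e = if S e then 1ℚ else 0ℚ

toℚ : (Edge → ℤ) → Edge → ℚ
toℚ α e = α e / 1

weightSum : List (Matching × ℚ) → ℚ
weightSum [] = 0ℚ
weightSum ((M , c) ∷ L) = c + weightSum L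

combo : List (Matching × ℚ) → Edge → ℚ
combo [] e = 0ℚ
combo ((M , c) ∷ L) e = c * χ M e + combo L e

-- x ∈ t · P_M(C*_5): x is a nonnegative combination of matching indicator
-- vectors with total weight t (i.e. x/t is a convex combination).
InDilate : ℕ → (Edge → ℚ) → Set
InDilate t x = ∃ λ (L : List (Matching × ℚ)) →
  All (λ p → 0ℚ ≤ proj₂ p) L × weightSum L ≡ (+ t) / 1 × (∀ e → combo L e ≡ x e)

LatticePt : ℕ → (Edge → ℤ) → Set
LatticePt t α = InDilate t (toℚ α)

sumVecs : (t : ℕ) → (Fin t → Edge → ℤ) → Edge → ℤ
sumVecs zero    as e = + 0
sumVecs (suc t) as e = as zero e Data.Integer.+ sumVecs t (λ i → as (suc i)) e

-- Write a, b, f for the weights of the triangle edges 01, 12, 02 and c, d, e for those of the path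
-- edges 23, 34, 40.  As a + b + f ≤ t, write t = a + b + f + r and think of t slots: a, b, f of them
-- holding 01, 12, 02 and r free ones, each to be completed by a matching of the path 2-3-4-0.  Here
-- 23 fits only beside 01, 40 only beside 12, 34 beside anything, and {23, 40} only in a free slot.
-- With k = min(c, e, r), put k copies of {23, 40} into free slots, the remaining 23s beside 01 and
-- then into free slots, likewise the 40s beside 12, and the 34s wherever room is left.  The degree
-- bounds at 0, 2, 3, 4 and the bound 2t on the total weight are exactly what makes this fit, in each
-- of the cases k = r, k = c and k = e.  These bounds hold on t·P_M because they hold for every
-- matching M: it meets each star and the triangle at most once, and 2|M| = Σ_v deg_M(v) ≤ 5.

module Submission where

open import Defs
open import Algebra.Bundles using (CommutativeMonoid)
import Algebra.Properties.CommutativeSemigroup as CommutativeSemigroupProperties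
open import Data.Bool using (true; false; if_then_else_) renaming (_≟_ to _≟ᵇ_)
open import Data.Bool.Properties using (¬-not)
open import Data.Fin using (Fin; zero; suc; #_; _≟_)
open import Data.Fin.Properties using (all?; any?)
open import Data.Integer as ℤ using (ℤ; +_; -[1+_])
import Data.Integer.Properties as ℤP
open import Data.List using (List; []; _∷_; map; foldr; filter; allFin)
open import Data.List.Properties using (map-cong; map-∘)
open import Data.List.Relation.Unary.All as All using (All)
open import Data.List.Relation.Unary.AllPairs as AllPairs using (AllPairs; allPairs?)
import Data.List.Relation.Unary.Any as Any
open import Data.Nat using (ℕ; zero; suc; _+_; _*_; _∸_; _≤_; _>_; z≤n; s≤s; s≤s⁻¹)
open import Data.Nat.ListAction using (sum)
open import Data.Nat.Properties
  using (+-assoc; +-comm; +-identityʳ; *-identityˡ; *-identityʳ; *-zeroʳ; +-mono-≤; +-cancelˡ-≤;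
         *-cancelˡ-<; ≤-reflexive; ≤-trans; ≤-total; _≤?_; ≰⇒≥; m≤n⇒∃[o]m+o≡n; m+[n∸m]≡n; m≤n+o⇒m∸n≤o;
         module ≤-Reasoning)
import Data.Nat.Coprimality as Coprime
open import Data.Nat.Tactic.RingSolver using (solve; solve-∀)
open import Data.Product using (Σ; ∃; ∃₂; _×_; _,_; proj₁; proj₂)
open import Data.Rational as ℚ using (ℚ; mkℚ; 0ℚ; 1ℚ)
import Data.Rational.Properties as ℚP
open import Data.Sum using (inj₁; inj₂)
open import Data.Vec as Vec using (Vec; _++_; replicate; lookup)
open import Function using (_∘_)
open import Relation.Binary.PropositionalEquality
open import Relation.Nullary using (Dec; yes; no; does; ¬?; _×-dec_; _⊎-dec_; _→-dec_)
open import Relation.Nullary.Decidable using (True; toWitness; from-yes)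

slack : ∀ m n → m ≤ n → ∃ λ o → m + o ≡ n
slack m n m≤n = m≤n⇒∃[o]m+o≡n m≤n

cancel-≤ : ∀ m x y {x′ y′} → x′ ≤ y′ → x′ ≡ m + x → y′ ≡ m + y → x ≤ y
cancel-≤ m x y x′≤y′ refl refl = +-cancelˡ-≤ m x y x′≤y′

riesz-decomposition : ∀ d x y → d ≤ x + y →
  ∃₂ λ d₁ d₂ → ∃ λ x′ → d ≡ d₁ + d₂ × x ≡ d₁ + x′ × d₂ ≤ y
riesz-decomposition d x y d≤x+y with d ≤? x
... | yes d≤x = let x′ , d+x′≡x = slack d x d≤x in d , 0 , x′ , sym (+-identityʳ d) , sym d+x′≡x , z≤n
... | no  d≰x = x , d ∸ x , 0 , sym (m+[n∸m]≡n (≰⇒≥ d≰x)) , sym (+-identityʳ x) , m≤n+o⇒m∸n≤o d x d≤x+y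

-- Unlike `sum`, no trailing `+ 0`: sums over concrete lists compute to exactly the expressions
-- written in the statements below.
sum′ : List ℕ → ℕ
sum′ [] = 0
sum′ (x ∷ []) = x
sum′ (x ∷ xs@(_ ∷ _)) = x + sum′ xs

sum′≡sum : ∀ xs → sum′ xs ≡ sum xs
sum′≡sum [] = refl
sum′≡sum (x ∷ []) = sym (+-identityʳ x)
sum′≡sum (x ∷ xs@(_ ∷ _)) = cong (_+_ x) (sum′≡sum xs)

ι : ℕ → ℚ
ι n = + n ℚ./ 1

ι-mkℚ : ∀ n → ι n ≡ mkℚ (+ n) 0 (Coprime.sym (Coprime.1-coprimeTo n))
ι-mkℚ n = ℚP.normalize-coprime _

ι-homo-+ : ∀ m n → ι (m + n) ≡ ι m ℚ.+ ι n
ι-homo-+ m n = sym (begin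
  ι m ℚ.+ ι n                          ≡⟨ cong₂ ℚ._+_ (ι-mkℚ m) (ι-mkℚ n) ⟩
  (+ m ℤ.* + 1 ℤ.+ + n ℤ.* + 1) ℚ./ 1
    ≡⟨ cong (ℚ._/ 1) (cong₂ ℤ._+_ (ℤP.*-identityʳ (+ m)) (ℤP.*-identityʳ (+ n))) ⟩
  (+ m ℤ.+ + n) ℚ./ 1                  ≡⟨ cong (ℚ._/ 1) (sym (ℤP.pos-+ m n)) ⟩
  ι (m + n)                            ∎)
  where open ≡-Reasoning

ι-homo-* : ∀ m n → ι (m * n) ≡ ι m ℚ.* ι n
ι-homo-* m n = sym (trans (cong₂ ℚ._*_ (ι-mkℚ m) (ι-mkℚ n)) (cong (ℚ._/ 1) (sym (ℤP.pos-* m n))))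

ι-mono-≤ : ∀ {m n} → m ≤ n → ι m ℚ.≤ ι n
ι-mono-≤ {m} {n} m≤n = subst₂ ℚ._≤_ (sym (ι-mkℚ m)) (sym (ι-mkℚ n))
  (ℚ.*≤* (subst₂ ℤ._≤_ (sym (ℤP.*-identityʳ (+ m))) (sym (ℤP.*-identityʳ (+ n))) (ℤ.+≤+ m≤n)))

ι-cancel-≤ : ∀ {m n} → ι m ℚ.≤ ι n → m ≤ n
ι-cancel-≤ {m} {n} ιm≤ιn with subst₂ ℚ._≤_ (ι-mkℚ m) (ι-mkℚ n) ιm≤ιn
... | ℚ.*≤* m≤n = ℤP.drop‿+≤+ (subst₂ ℤ._≤_ (ℤP.*-identityʳ (+ m)) (ℤP.*-identityʳ (+ n)) m≤n)

0≤i/1⇒i≡+∣i∣ : ∀ i → 0ℚ ℚ.≤ i ℚ./ 1 → i ≡ + ℤ.∣ i ∣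
0≤i/1⇒i≡+∣i∣ (+ n) _ = refl
0≤i/1⇒i≡+∣i∣ -[1+ n ] 0≤i/1
  with subst (0ℚ ℚ.≤_) (cong ℚ.-_ (ℚP.normalize-coprime (Coprime.sym (Coprime.1-coprimeTo (suc n))))) 0≤i/1
... | ℚ.*≤* ()

Σℚ : List ℚ → ℚ
Σℚ = foldr ℚ._+_ 0ℚ

Σℚ-ι : ∀ xs → Σℚ (map ι xs) ≡ ι (sum xs)
Σℚ-ι [] = refl
Σℚ-ι (x ∷ xs) = trans (cong (ι x ℚ.+_) (Σℚ-ι xs)) (sym (ι-homo-+ x (sum xs)))

Σℚ-zero : ∀ {A : Set} (xs : List A) → Σℚ (map (λ _ → 0ℚ) xs) ≡ 0ℚ
Σℚ-zero [] = refl
Σℚ-zero (_ ∷ xs) = trans (ℚP.+-identityˡ _) (Σℚ-zero xs)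

Σℚ-linear : ∀ {A : Set} c (u v : A → ℚ) xs →
  Σℚ (map (λ x → c ℚ.* u x ℚ.+ v x) xs) ≡ c ℚ.* Σℚ (map u xs) ℚ.+ Σℚ (map v xs)
Σℚ-linear c u v [] = sym (trans (ℚP.+-identityʳ _) (ℚP.*-zeroʳ c))
Σℚ-linear c u v (x ∷ xs) = begin
  (c ℚ.* u x ℚ.+ v x) ℚ.+ Σℚ (map (λ y → c ℚ.* u y ℚ.+ v y) xs)
    ≡⟨ cong (c ℚ.* u x ℚ.+ v x ℚ.+_) (Σℚ-linear c u v xs) ⟩
  (c ℚ.* u x ℚ.+ v x) ℚ.+ (c ℚ.* Σℚ (map u xs) ℚ.+ Σℚ (map v xs))
    ≡⟨ interchange (c ℚ.* u x) (v x) _ _ ⟩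
  (c ℚ.* u x ℚ.+ c ℚ.* Σℚ (map u xs)) ℚ.+ (v x ℚ.+ Σℚ (map v xs))
    ≡⟨ cong (ℚ._+ _) (sym (ℚP.*-distribˡ-+ c (u x) _)) ⟩
  c ℚ.* Σℚ (map u (x ∷ xs)) ℚ.+ Σℚ (map v (x ∷ xs)) ∎
  where
  open ≡-Reasoning
  open CommutativeSemigroupProperties (CommutativeMonoid.commutativeSemigroup ℚP.+-0-commutativeMonoid)

-- Matchings of C*_5

pattern e01 = zero
pattern e12 = suc zero
pattern e23 = suc (suc zero)
pattern e34 = suc (suc (suc zero))
pattern e40 = suc (suc (suc (suc zero)))
pattern e02 = suc (suc (suc (suc (suc zero))))

edgewise : {P : Edge → Set} → P e01 → P e12 → P e23 → P e34 → P e40 → P e02 → ∀ ε → P ε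
edgewise p _ _ _ _ _ e01 = p
edgewise _ p _ _ _ _ e12 = p
edgewise _ _ p _ _ _ e23 = p
edgewise _ _ _ p _ _ e34 = p
edgewise _ _ _ _ p _ e40 = p
edgewise _ _ _ _ _ p e02 = p

edgeVector : ℕ → ℕ → ℕ → ℕ → ℕ → ℕ → Edge → ℕ
edgeVector a b c d e f = edgewise a b c d e f

incident? : ∀ v ε → Dec (Incident v ε)
incident? v ε = v ≟ proj₁ (ends ε) ⊎-dec v ≟ proj₂ (ends ε)

isMatching? : ∀ S → Dec (IsMatching S)
isMatching? S = all? λ ε → all? λ ε′ →
  S ε ≟ᵇ true →-dec S ε′ ≟ᵇ true →-dec ¬? (ε ≟ ε′) →-dec
  all? λ v → incident? v ε →-dec ¬? (incident? v ε′)

⟪_⟫ : (R : List Edge) → {True (isMatching? (λ ε → does (Any.any? (ε ≟_) R)))} → Matching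
⟪ R ⟫ {isM} = (λ ε → does (Any.any? (ε ≟_) R)) , toWitness isM

bit : Matching → Edge → ℕ
bit (S , _) ε = if S ε then 1 else 0

⟦_⟧ : Matching → Edge → ℤ
⟦ M ⟧ ε = + bit M ε

χ-ι : ∀ M ε → χ M ε ≡ ι (bit M ε)
χ-ι (S , _) ε with S ε
... | true  = refl
... | false = refl

Adjacent : Edge → Edge → Set
Adjacent ε ε′ = ε ≢ ε′ × ∃ λ v → Incident v ε × Incident v ε′

adjacent? : ∀ ε ε′ → Dec (Adjacent ε ε′)
adjacent? ε ε′ = ¬? (ε ≟ ε′) ×-dec any? λ v → incident? v ε ×-dec incident? v ε′

star : Vertex → List Edge
star v = filter (incident? v) (allFin 6)

triangle : List Edge
triangle = e01 ∷ e12 ∷ e02 ∷ []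

stars-are-cliques : ∀ v → AllPairs Adjacent (star v)
stars-are-cliques = from-yes (all? λ v → allPairs? adjacent? (star v))

triangle-is-clique : AllPairs Adjacent triangle
triangle-is-clique = from-yes (allPairs? adjacent? triangle)

matching-excludes-adjacent : ∀ (M : Matching) {ε ε′} → proj₁ M ε ≡ true → Adjacent ε ε′ → proj₁ M ε′ ≡ false
matching-excludes-adjacent (S , isM) {ε} {ε′} Sε (ε≢ε′ , v , vε , vε′) =
  ¬-not λ Sε′ → isM ε ε′ Sε Sε′ ε≢ε′ v vε vε′

sum-bits-outside : ∀ (M : Matching) {R} → All (λ ε → proj₁ M ε ≡ false) R → sum (map (bit M) R) ≡ 0
sum-bits-outside M All.[] = refl
sum-bits-outside M@(S , _) {ε ∷ _} (Sε All.∷ outside) rewrite Sε = sum-bits-outside M outside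

matching-clique-≤1 : ∀ (M : Matching) {R} → AllPairs Adjacent R → sum (map (bit M) R) ≤ 1
matching-clique-≤1 M AllPairs.[] = z≤n
matching-clique-≤1 M@(S , _) {ε ∷ R} (adjacent AllPairs.∷ clique) with S ε in Sε
... | true  = ≤-reflexive (cong suc (sum-bits-outside M (All.map (matching-excludes-adjacent M Sε) adjacent)))
... | false = matching-clique-≤1 M clique

handshake : ∀ (x : Edge → ℕ) → let deg = λ v → sum′ (map x (star v)) in
  deg (# 0) + deg (# 1) + deg (# 2) + deg (# 3) + deg (# 4) ≡ 2 * sum′ (map x (allFin 6))
handshake x = counted-twice (x e01) (x e12) (x e23) (x e34) (x e40) (x e02)
  where
  counted-twice : ∀ a b c d e f →
    a + (e + f) + (a + b) + (b + (c + f)) + (c + d) + (d + e) ≡ 2 * (a + (b + (c + (d + (e + f)))))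
  counted-twice = solve-∀

matching-size-≤2 : ∀ (M : Matching) → sum (map (bit M) (allFin 6)) ≤ 2
matching-size-≤2 M = s≤s⁻¹ (*-cancelˡ-< 2 _ 3 (s≤s (begin
  2 * sum (map (bit M) (allFin 6))    ≡⟨ cong (2 *_) (sym (sum′≡sum (map (bit M) (allFin 6)))) ⟩
  2 * sum′ (map (bit M) (allFin 6))   ≡⟨ sym (handshake (bit M)) ⟩
  deg (# 0) + deg (# 1) + deg (# 2) + deg (# 3) + deg (# 4)
    ≤⟨ +-mono-≤ (+-mono-≤ (+-mono-≤ (+-mono-≤ (deg≤1 (# 0)) (deg≤1 (# 1))) (deg≤1 (# 2))) (deg≤1 (# 3)))
                (deg≤1 (# 4)) ⟩
  5                                   ∎)))
  where
  open ≤-Reasoning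
  deg : Vertex → ℕ
  deg v = sum′ (map (bit M) (star v))
  deg≤1 : ∀ v → deg v ≤ 1
  deg≤1 v = subst (_≤ 1) (sym (sum′≡sum (map (bit M) (star v)))) (matching-clique-≤1 M (stars-are-cliques v))

-- Inequalities valid on t·P_M(C*_5)

NonNegWeights : List (Matching × ℚ) → Set
NonNegWeights = All (λ p → 0ℚ ℚ.≤ proj₂ p)

combo-row-≤ : ∀ R K L → NonNegWeights L → (∀ M → Σℚ (map (χ M) R) ℚ.≤ K) →
  Σℚ (map (combo L) R) ℚ.≤ K ℚ.* weightSum L
combo-row-≤ R K [] All.[] _ = ℚP.≤-reflexive (trans (Σℚ-zero R) (sym (ℚP.*-zeroʳ K)))
combo-row-≤ R K ((M , c) ∷ L) (0≤c All.∷ nonNeg) bound = begin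
  Σℚ (map (combo ((M , c) ∷ L)) R)                  ≡⟨ Σℚ-linear c (χ M) (combo L) R ⟩
  c ℚ.* Σℚ (map (χ M) R) ℚ.+ Σℚ (map (combo L) R)
    ≤⟨ ℚP.+-mono-≤ (ℚP.*-monoˡ-≤-nonNeg c {{ℚ.nonNegative 0≤c}} (bound M)) (combo-row-≤ R K L nonNeg bound) ⟩
  c ℚ.* K ℚ.+ K ℚ.* weightSum L                     ≡⟨ cong (ℚ._+ _) (ℚP.*-comm c K) ⟩
  K ℚ.* c ℚ.+ K ℚ.* weightSum L                     ≡⟨ sym (ℚP.*-distribˡ-+ K c _) ⟩
  K ℚ.* weightSum ((M , c) ∷ L)                     ∎
  where open ℚP.≤-Reasoning

combo-nonNeg : ∀ L → NonNegWeights L → ∀ ε → 0ℚ ℚ.≤ combo L ε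
combo-nonNeg [] All.[] ε = ℚP.≤-refl
combo-nonNeg ((M , c) ∷ L) (0≤c All.∷ nonNeg) ε =
  subst (ℚ._≤ combo ((M , c) ∷ L) ε) (trans (ℚP.+-identityʳ _) (ℚP.*-zeroʳ c))
    (ℚP.+-mono-≤ (ℚP.*-monoˡ-≤-nonNeg c {{ℚ.nonNegative 0≤c}} 0≤χ) (combo-nonNeg L nonNeg ε))
  where
  0≤χ : 0ℚ ℚ.≤ χ M ε
  0≤χ = subst (0ℚ ℚ.≤_) (sym (χ-ι M ε)) (ι-mono-≤ {0} {bit M ε} z≤n)

lattice-point-nonNeg : ∀ {t α} → LatticePt t α → ∀ ε → α ε ≡ + ℤ.∣ α ε ∣
lattice-point-nonNeg {α = α} (L , nonNeg , _ , combo≡α) ε =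
  0≤i/1⇒i≡+∣i∣ (α ε) (subst (0ℚ ℚ.≤_) (combo≡α ε) (combo-nonNeg L nonNeg ε))

lattice-row-bound : ∀ {t α n} R K → (∀ M → sum (map (bit M) R) ≤ K) →
  LatticePt t α → (∀ ε → α ε ≡ + n ε) → sum (map n R) ≤ K * t
lattice-row-bound {t} {α} {n} R K bound (L , nonNeg , weight≡t , combo≡α) α≡n = ι-cancel-≤ (begin
  ι (sum (map n R))            ≡⟨ sym (Σℚ-ι (map n R)) ⟩
  Σℚ (map ι (map n R))         ≡⟨ cong Σℚ (sym (map-∘ R)) ⟩
  Σℚ (map (ι ∘ n) R)           ≡⟨ cong Σℚ (map-cong (λ ε → sym (trans (combo≡α ε) (cong (ℚ._/ 1) (α≡n ε)))) R) ⟩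
  Σℚ (map (combo L) R)         ≤⟨ combo-row-≤ R (ι K) L nonNeg matching-row ⟩
  ι K ℚ.* weightSum L          ≡⟨ cong (ι K ℚ.*_) weight≡t ⟩
  ι K ℚ.* ι t                  ≡⟨ sym (ι-homo-* K t) ⟩
  ι (K * t)                    ∎)
  where
  open ℚP.≤-Reasoning
  matching-row : ∀ M → Σℚ (map (χ M) R) ℚ.≤ ι K
  matching-row M = begin
    Σℚ (map (χ M) R)             ≡⟨ cong Σℚ (trans (map-cong (χ-ι M) R) (map-∘ R)) ⟩
    Σℚ (map ι (map (bit M) R))   ≡⟨ Σℚ-ι (map (bit M) R) ⟩
    ι (sum (map (bit M) R))      ≤⟨ ι-mono-≤ (bound M) ⟩
    ι K                          ∎

record RowBounds (t : ℕ) (n : Edge → ℕ) : Set where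
  field
    star-bound     : ∀ v → sum′ (map n (star v)) ≤ t
    triangle-bound : sum′ (map n triangle) ≤ t
    size-bound     : sum′ (map n (allFin 6)) ≤ 2 * t

lattice-point-row-bounds : ∀ {t α n} → LatticePt t α → (∀ ε → α ε ≡ + n ε) → RowBounds t n
lattice-point-row-bounds {t} {n = n} lp α≡n = record
  { star-bound     = λ v → clique-bound (stars-are-cliques v)
  ; triangle-bound = clique-bound triangle-is-clique
  ; size-bound     = subst (_≤ 2 * t) (sym (sum′≡sum (map n (allFin 6))))
                       (lattice-row-bound {t} (allFin 6) 2 matching-size-≤2 lp α≡n)
  }
  where
  clique-bound : ∀ {R} → AllPairs Adjacent R → sum′ (map n R) ≤ t
  clique-bound {R} clique = subst₂ _≤_ (sym (sum′≡sum (map n R))) (*-identityˡ t)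
    (lattice-row-bound R 1 (λ M → matching-clique-≤1 M clique) lp α≡n)

matching-lattice-point : ∀ M → LatticePt 1 ⟦ M ⟧
matching-lattice-point M = ((M , 1ℚ) ∷ []) , (ι-mono-≤ {0} {1} z≤n All.∷ All.[]) , refl , combo≡ M
  where
  combo≡ : ∀ M ε → combo ((M , 1ℚ) ∷ []) ε ≡ toℚ ⟦ M ⟧ ε
  combo≡ (S , _) ε with S ε
  ... | true  = refl
  ... | false = refl

-- Filling t slots

count : ∀ {t} → Vec Matching t → Edge → ℕ
count Vec.[] ε = 0
count (M Vec.∷ Ms) ε = bit M ε + count Ms ε

count-++ : ∀ {s t} (Ms : Vec Matching s) (Ns : Vec Matching t) ε → count (Ms ++ Ns) ε ≡ count Ms ε + count Ns ε
count-++ Vec.[] Ns ε = refl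
count-++ (M Vec.∷ Ms) Ns ε = trans (cong (_+_ (bit M ε)) (count-++ Ms Ns ε)) (sym (+-assoc (bit M ε) _ _))

count-replicate : ∀ k M ε → count (replicate k M) ε ≡ k * bit M ε
count-replicate zero M ε = refl
count-replicate (suc k) M ε = cong (_+_ (bit M ε)) (count-replicate k M ε)

sumVecs-lookup : ∀ {t} (Ms : Vec Matching t) ε → sumVecs t (λ i → ⟦ lookup Ms i ⟧) ε ≡ + count Ms ε
sumVecs-lookup Vec.[] ε = refl
sumVecs-lookup (M Vec.∷ Ms) ε =
  trans (cong (ℤ._+_ (⟦ M ⟧ ε)) (sumVecs-lookup Ms ε)) (sym (ℤP.pos-+ (bit M ε) (count Ms ε)))

Decomposition : ℕ → (Edge → ℕ) → Set
Decomposition t n = Σ (Vec Matching t) λ Ms → ∀ ε → count Ms ε ≡ n ε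

Plan : Set
Plan = List (ℕ × Matching)

size : Plan → ℕ
size p = sum (map proj₁ p)

multiplicities : Plan → Edge → List ℕ
multiplicities [] ε = []
multiplicities ((k , M) ∷ p) ε = if proj₁ M ε then k ∷ multiplicities p ε else multiplicities p ε

weight : Plan → Edge → ℕ
weight p ε = sum′ (multiplicities p ε)

expand : (p : Plan) → Vec Matching (size p)
expand [] = Vec.[]
expand ((k , M) ∷ p) = replicate k M ++ expand p

count-expand : ∀ p ε → count (expand p) ε ≡ sum (multiplicities p ε)
count-expand [] ε = refl
count-expand ((k , M@(S , _)) ∷ p) ε
  rewrite count-++ (replicate k M) (expand p) ε | count-replicate k M ε | count-expand p ε with S ε
... | true  = cong (_+ sum (multiplicities p ε)) (*-identityʳ k)
... | false = cong (_+ sum (multiplicities p ε)) (*-zeroʳ k)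

plan-decomposition : ∀ {t n} (p : Plan) → sum′ (map proj₁ p) ≡ t → (∀ ε → weight p ε ≡ n ε) → Decomposition t n
plan-decomposition p size≡t weight≡n with trans (sym (sum′≡sum (map proj₁ p))) size≡t
... | refl = expand p , λ ε →
  trans (count-expand p ε) (trans (sym (sum′≡sum (multiplicities p ε))) (weight≡n ε))

-- Each plan lists its entries in the order in which the slack variables are nested in the
-- coordinates, so that its weights compute to these coordinates and the edgewise proofs are refl.
decompose-r-min : ∀ a b f r c d e → r ≤ c → r ≤ e → c ≤ a + r → e ≤ b + r → c + d + e ≤ a + (b + f) + r + r →
  Decomposition (a + (b + f) + r) (edgeVector a b c d e f)
decompose-r-min a b f r c d e r≤c r≤e c≤a+r e≤b+r cde≤
  with slack r c r≤c | slack r e r≤e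
... | c₁ , refl | e₁ , refl
  with slack c₁ a (cancel-≤ r c₁ a c≤a+r refl (+-comm a r))
     | slack e₁ b (cancel-≤ r e₁ b e≤b+r refl (+-comm b r))
... | a₁ , refl | b₁ , refl
  with riesz-decomposition d a₁ (b₁ + f)
         (cancel-≤ (r + r + c₁ + e₁) d (a₁ + (b₁ + f)) cde≤
                   (solve (r ∷ c₁ ∷ d ∷ e₁ ∷ [])) (solve (r ∷ c₁ ∷ e₁ ∷ a₁ ∷ b₁ ∷ f ∷ [])))
... | d₁ , d′ , a₂ , refl , refl , d′≤b₁+f with riesz-decomposition d′ b₁ f d′≤b₁+f
... | d₂ , d₃ , b₂ , refl , refl , d₃≤f with slack d₃ f d₃≤f
... | f₂ , refl = plan-decomposition
  ( (r  , ⟪ e23 ∷ e40 ∷ [] ⟫) ∷ (c₁ , ⟪ e01 ∷ e23 ∷ [] ⟫) ∷ (e₁ , ⟪ e12 ∷ e40 ∷ [] ⟫)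
  ∷ (d₁ , ⟪ e01 ∷ e34 ∷ [] ⟫) ∷ (d₂ , ⟪ e12 ∷ e34 ∷ [] ⟫) ∷ (d₃ , ⟪ e02 ∷ e34 ∷ [] ⟫)
  ∷ (a₂ , ⟪ e01 ∷ [] ⟫) ∷ (b₂ , ⟪ e12 ∷ [] ⟫) ∷ (f₂ , ⟪ e02 ∷ [] ⟫) ∷ [])
  slots (edgewise refl refl refl refl refl refl)
  where
  slots : r + (c₁ + (e₁ + (d₁ + (d₂ + (d₃ + (a₂ + (b₂ + f₂)))))))
        ≡ c₁ + (d₁ + a₂) + (e₁ + (d₂ + b₂) + (d₃ + f₂)) + r
  slots = solve (r ∷ c₁ ∷ e₁ ∷ d₁ ∷ d₂ ∷ d₃ ∷ a₂ ∷ b₂ ∷ f₂ ∷ [])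

decompose-c-min : ∀ a b f r c d e → c ≤ r → c ≤ e → e ≤ b + r → d + e ≤ a + (b + f) + r →
  Decomposition (a + (b + f) + r) (edgeVector a b c d e f)
decompose-c-min a b f r c d e c≤r c≤e e≤b+r de≤
  with slack c r c≤r | slack c e c≤e
... | r₁ , refl | e₁ , refl
  with riesz-decomposition e₁ b r₁ (cancel-≤ c e₁ (b + r₁) e≤b+r refl (solve (b ∷ c ∷ r₁ ∷ [])))
... | e₂ , e₃ , b₁ , refl , refl , e₃≤r₁ with slack e₃ r₁ e₃≤r₁
... | r₂ , refl
  with riesz-decomposition d a (b₁ + (f + r₂))
         (cancel-≤ (c + e₂ + e₃) d (a + (b₁ + (f + r₂))) de≤
                   (solve (c ∷ d ∷ e₂ ∷ e₃ ∷ [])) (solve (a ∷ b₁ ∷ c ∷ e₂ ∷ e₃ ∷ f ∷ r₂ ∷ [])))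
... | d₁ , d′ , a₁ , refl , refl , d′≤b₁+f+r₂ with riesz-decomposition d′ b₁ (f + r₂) d′≤b₁+f+r₂
... | d₂ , d″ , b₂ , refl , refl , d″≤f+r₂ with riesz-decomposition d″ f r₂ d″≤f+r₂
... | d₃ , d₄ , f₁ , refl , refl , d₄≤r₂ with slack d₄ r₂ d₄≤r₂
... | r₃ , refl = plan-decomposition
  ( (c  , ⟪ e23 ∷ e40 ∷ [] ⟫) ∷ (e₂ , ⟪ e12 ∷ e40 ∷ [] ⟫) ∷ (e₃ , ⟪ e40 ∷ [] ⟫)
  ∷ (d₁ , ⟪ e01 ∷ e34 ∷ [] ⟫) ∷ (d₂ , ⟪ e12 ∷ e34 ∷ [] ⟫) ∷ (d₃ , ⟪ e02 ∷ e34 ∷ [] ⟫) ∷ (d₄ , ⟪ e34 ∷ [] ⟫)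
  ∷ (a₁ , ⟪ e01 ∷ [] ⟫) ∷ (b₂ , ⟪ e12 ∷ [] ⟫) ∷ (f₁ , ⟪ e02 ∷ [] ⟫) ∷ (r₃ , ⟪ [] ⟫) ∷ [])
  slots (edgewise refl refl refl refl refl refl)
  where
  slots : c + (e₂ + (e₃ + (d₁ + (d₂ + (d₃ + (d₄ + (a₁ + (b₂ + (f₁ + r₃)))))))))
        ≡ d₁ + a₁ + (e₂ + (d₂ + b₂) + (d₃ + f₁)) + (c + (e₃ + (d₄ + r₃)))
  slots = solve (c ∷ e₂ ∷ e₃ ∷ d₁ ∷ d₂ ∷ d₃ ∷ d₄ ∷ a₁ ∷ b₂ ∷ f₁ ∷ r₃ ∷ [])

decompose-e-min : ∀ a b f r c d e → e ≤ r → e ≤ c → c ≤ a + r → c + d ≤ a + (b + f) + r →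
  Decomposition (a + (b + f) + r) (edgeVector a b c d e f)
decompose-e-min a b f r c d e e≤r e≤c c≤a+r cd≤
  with slack e r e≤r | slack e c e≤c
... | r₁ , refl | c₁ , refl
  with riesz-decomposition c₁ a r₁ (cancel-≤ e c₁ (a + r₁) c≤a+r refl (solve (a ∷ e ∷ r₁ ∷ [])))
... | c₂ , c₃ , a₁ , refl , refl , c₃≤r₁ with slack c₃ r₁ c₃≤r₁
... | r₂ , refl
  with riesz-decomposition d b (a₁ + (f + r₂))
         (cancel-≤ (e + c₂ + c₃) d (b + (a₁ + (f + r₂))) cd≤
                   (solve (e ∷ d ∷ c₂ ∷ c₃ ∷ [])) (solve (b ∷ a₁ ∷ e ∷ c₂ ∷ c₃ ∷ f ∷ r₂ ∷ [])))
... | d₁ , d′ , b₁ , refl , refl , d′≤a₁+f+r₂ with riesz-decomposition d′ a₁ (f + r₂) d′≤a₁+f+r₂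
... | d₂ , d″ , a₂ , refl , refl , d″≤f+r₂ with riesz-decomposition d″ f r₂ d″≤f+r₂
... | d₃ , d₄ , f₁ , refl , refl , d₄≤r₂ with slack d₄ r₂ d₄≤r₂
... | r₃ , refl = plan-decomposition
  ( (e  , ⟪ e23 ∷ e40 ∷ [] ⟫) ∷ (c₂ , ⟪ e01 ∷ e23 ∷ [] ⟫) ∷ (c₃ , ⟪ e23 ∷ [] ⟫)
  ∷ (d₁ , ⟪ e12 ∷ e34 ∷ [] ⟫) ∷ (d₂ , ⟪ e01 ∷ e34 ∷ [] ⟫) ∷ (d₃ , ⟪ e02 ∷ e34 ∷ [] ⟫) ∷ (d₄ , ⟪ e34 ∷ [] ⟫)
  ∷ (b₁ , ⟪ e12 ∷ [] ⟫) ∷ (a₂ , ⟪ e01 ∷ [] ⟫) ∷ (f₁ , ⟪ e02 ∷ [] ⟫) ∷ (r₃ , ⟪ [] ⟫) ∷ [])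
  slots (edgewise refl refl refl refl refl refl)
  where
  slots : e + (c₂ + (c₃ + (d₁ + (d₂ + (d₃ + (d₄ + (b₁ + (a₂ + (f₁ + r₃)))))))))
        ≡ c₂ + (d₂ + a₂) + (d₁ + b₁ + (d₃ + f₁)) + (e + (c₃ + (d₄ + r₃)))
  slots = solve (e ∷ c₂ ∷ c₃ ∷ d₁ ∷ d₂ ∷ d₃ ∷ d₄ ∷ b₁ ∷ a₂ ∷ f₁ ∷ r₃ ∷ [])

decompose-slots : ∀ a b f r c d e → e ≤ b + r → c ≤ a + r → c + d ≤ a + (b + f) + r → d + e ≤ a + (b + f) + r →
  c + d + e ≤ a + (b + f) + r + r → Decomposition (a + (b + f) + r) (edgeVector a b c d e f)
decompose-slots a b f r c d e e≤b+r c≤a+r cd≤ de≤ cde≤ with ≤-total c e | ≤-total r c | ≤-total r e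
... | inj₁ c≤e | inj₁ r≤c | _        = decompose-r-min a b f r c d e r≤c (≤-trans r≤c c≤e) c≤a+r e≤b+r cde≤
... | inj₁ c≤e | inj₂ c≤r | _        = decompose-c-min a b f r c d e c≤r c≤e e≤b+r de≤
... | inj₂ e≤c | _        | inj₁ r≤e = decompose-r-min a b f r c d e (≤-trans r≤e e≤c) r≤e c≤a+r e≤b+r cde≤
... | inj₂ e≤c | _        | inj₂ e≤r = decompose-e-min a b f r c d e e≤r e≤c c≤a+r cd≤

decompose : ∀ {t} a b c d e f → RowBounds t (edgeVector a b c d e f) → Decomposition t (edgeVector a b c d e f)
decompose {t} a b c d e f bounds with slack (a + (b + f)) t (RowBounds.triangle-bound bounds)
... | r , refl = decompose-slots a b f r c d e
  (cancel-≤ (a + f) e (b + r) deg₀ (solve vars) (solve vars))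
  (cancel-≤ (b + f) c (a + r) deg₂ (solve vars) (solve vars))
  (star-bound (# 3))
  (star-bound (# 4))
  (cancel-≤ (a + (b + f)) (c + d + e) (a + (b + f) + r + r) total (solve vars) (solve vars))
  where
  open RowBounds bounds
  vars : List ℕ
  vars = a ∷ b ∷ c ∷ d ∷ e ∷ f ∷ r ∷ []
  deg₀ : a + (e + f) ≤ a + (b + f) + r
  deg₀ = star-bound (# 0)
  deg₂ : b + (c + f) ≤ a + (b + f) + r
  deg₂ = star-bound (# 2)
  total : a + (b + (c + (d + (e + f)))) ≤ 2 * (a + (b + f) + r)
  total = size-bound

lemma3p12 : (t : ℕ) → t > 0 → (α : Edge → ℤ) → LatticePt t α →
    Σ (Fin t → Edge → ℤ) (λ αs → ((i : Fin t) → LatticePt 1 (αs i)) × (∀ e → α e ≡ sumVecs t αs e))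
lemma3p12 t _ α lp =
  (λ i → ⟦ lookup Ms i ⟧) , (λ i → matching-lattice-point (lookup Ms i)) ,
  λ ε → trans (α≡n ε) (trans (cong ℤ.+_ (sym (count≡n ε))) (sym (sumVecs-lookup Ms ε)))
  where
  nonNeg : ∀ ε → α ε ≡ + ℤ.∣ α ε ∣
  nonNeg = lattice-point-nonNeg {t} lp
  n : Edge → ℕ
  n = edgeVector ℤ.∣ α e01 ∣ ℤ.∣ α e12 ∣ ℤ.∣ α e23 ∣ ℤ.∣ α e34 ∣ ℤ.∣ α e40 ∣ ℤ.∣ α e02 ∣
  α≡n : ∀ ε → α ε ≡ + n ε
  α≡n = edgewise (nonNeg e01) (nonNeg e12) (nonNeg e23) (nonNeg e34) (nonNeg e40) (nonNeg e02)
  decomposition : Decomposition t n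
  decomposition = decompose _ _ _ _ _ _ (lattice-point-row-bounds lp α≡n)
  Ms : Vec Matching t
  Ms = proj₁ decomposition
  count≡n : ∀ ε → count Ms ε ≡ n ε
  count≡n = proj₂ decomposition
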